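{- For every MDSP instance with $m$ drones, the algorithm GreedyAlgoForMDSP (described in the context) always outputs a feasible solution for the instance with $m$ drones, i.e., $m$ pairwise disjoint feasible sets of deliveries.
   Context: An MDSP instance consists of deliveries $\mathcal{N}=\{1,\dots,n\}$ and $m$ drones, each with the same battery budget $B>0$. Each delivery $j$ has a closed delivery time interval $I_j=[t_j^L,t_j^R]$, a cost $c_j>0$ with $c_j\le B$, and a profit $p_j\ge 0$. Deliveries $j\ne k$ are compatible if $I_j\cap I_k=\emptyset$. A set $S\subseteq\mathcal{N}$ is compatible if its elements are pairwise compatible and feasible if additionally $\mathcal{W}(S)=\sum_{j\in S}c_j\le B$; its profit is $\mathcal{P}(S)=\sum_{j\in S}p_j$. A feasible solution is a family $S_1,\dots,S_m$ of pairwise disjoint feasible sets. The density of $j$ is $d_j=p_j/c_j$. The interval graph has vertex set $\mathcal{N}$ and an edge between $j\neq k$ iff $I_j\cap I_k\neq\emptyset$; $\Delta$ is its maximum degree. Algorithm GreedyAlgoForMDSP: Use $m+\Delta$ slots $i=1,\dots,m+\Delta$, each with a set $S_i$ (initially $\emptyset$), cost $W_i=\mathcal{W}(S_i)$ and profit $P_i=\mathcal{P}(S_i)$; let $M$ (initially all slots) be the open slots and $M'$ (initially $\emptyset$) the closed slots. Sort the deliveries so that $d_1\ge d_2\ge\dots\ge d_n$. For $j=1,\dots,n$: if $|M'|=m$, stop the loop; otherwise choose a slot $i\in M$ such that $I_j$ is disjoint from every interval $I_k$ with $k\in S_i$, and add $j$ to $S_i$ (updating $W_i,P_i$); if now $W_i>B$,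 move $i$ from $M$ to $M'$ and set $L_i=\{j\}$. After the loop, for each $i\in M'$: if $\mathcal{P}(S_i\setminus L_i)\ge\mathcal{P}(L_i)$, replace $S_i$ by $S_i\setminus L_i$; otherwise replace $S_i$ by $L_i$ (updating $W_i,P_i$). Finally output the $m$ slots with the largest $P_i$ among all $m+\Delta$ slots, together with their sets $S_i$.
   Formalization: The interval endpoints $t_j^L,t_j^R$, the costs $c_j$, the profits $p_j$ and the budget $B$ of each MDSP instance are rational. -}

module Defs where

open import Data.Bool using (Bool; true; false; if_then_else_)
open import Data.Empty using (⊥)
open import Data.Fin using (Fin; _≟_)
open import Data.List using (List; []; _∷_; foldr; filter; length; map; allFin)
open import Data.Nat.ListAction using (sum)
open import Data.List.Membership.Propositional using (_∈_)
open import Data.List.Relation.Unary.All using (All)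
open import Data.List.Relation.Unary.AllPairs using (AllPairs)
open import Data.List.Relation.Unary.Linked using (Linked)
open import Data.List.Relation.Unary.Unique.Propositional using (Unique)
open import Data.List.Relation.Binary.Permutation.Propositional using (_↭_)
open import Data.Maybe using (Maybe; just; nothing)
open import Data.Nat as ℕ using (ℕ; zero; suc)
open import Data.Product using (Σ; ∃; ∃-syntax; _×_; _,_)
open import Data.Sum using (_⊎_)
open import Data.Rational as ℚ using (ℚ; 0ℚ; _+_; _÷_)
open import Data.Rational.Properties as ℚP using (pos⇒nonZero)
open import Relation.Binary.PropositionalEquality using (_≡_; _≢_)
open import Relation.Nullary using (¬_; does; ¬?)

record Instance : Set where
  field
    n m      : ℕ
    B        : ℚ
    tL tR    : Fin n → ℚ
    c p      : Fin n → ℚ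
    B-pos    : 0ℚ ℚ.< B
    interval : ∀ j → tL j ℚ.≤ tR j
    c-pos    : ∀ j → 0ℚ ℚ.< c j
    c≤B      : ∀ j → c j ℚ.≤ B
    p-nonneg : ∀ j → 0ℚ ℚ.≤ p j

module MDSP (inst : Instance) where
  open Instance inst public

  _∈I_ : ℚ → Fin n → Set
  t ∈I j = tL j ℚ.≤ t × t ℚ.≤ tR j

  Intersect : Fin n → Fin n → Set
  Intersect j k = ∃[ t ] (t ∈I j × t ∈I k)

  DisjointI : Fin n → Fin n → Set
  DisjointI j k = ¬ Intersect j k

  𝒲 : List (Fin n) → ℚ
  𝒲 = foldr (λ j acc → c j + acc) 0ℚ

  𝒫 : List (Fin n) → ℚ
  𝒫 = foldr (λ j acc → p j + acc) 0ℚ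

  -- compatible set: elements pairwise compatible (this also forces the
  -- list to be duplicate-free, since every I_j is nonempty)
  CompatibleSet : List (Fin n) → Set
  CompatibleSet S = AllPairs DisjointI S

  FeasibleSet : List (Fin n) → Set
  FeasibleSet S = CompatibleSet S × 𝒲 S ℚ.≤ B

  FeasibleSolution : (Fin m → List (Fin n)) → Set
  FeasibleSolution S =
    (∀ a → FeasibleSet (S a)) ×
    (∀ a b → a ≢ b → ∀ j → j ∈ S a → j ∈ S b → ⊥)

  NeighbourList : Fin n → List (Fin n) → Set
  NeighbourList j ns = Unique ns × All (λ k → k ≢ j × Intersect j k) ns

  IsMaxDegree : ℕ → Set
  IsMaxDegree Δ =
    (∀ j ns → NeighbourList j ns → length ns ℕ.≤ Δ) ×
    (Δ ≡ 0 ⊎ (∃[ j ] ∃[ ns ] (NeighbourList j ns × length ns ≡ Δ)))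

  density : Fin n → ℚ
  density j = _÷_ (p j) (c j) {{pos⇒nonZero (c j) {{ℚ.positive (c-pos j)}}}}

  SortedByDensity : List (Fin n) → Set
  SortedByDensity ord = (ord ↭ allFin n) × Linked (λ j k → density k ℚ.≤ density j) ord

  module Greedy (Δ : ℕ) where
    K : ℕ
    K = m ℕ.+ Δ

    -- state of the main loop: the sets S_i, whether slot i is closed
    -- (i ∈ M'), and L_i (= just j) for closed slots
    record State : Set where
      field
        sets   : Fin K → List (Fin n)
        closed : Fin K → Bool
        last   : Fin K → Maybe (Fin n)
    open State public

    init : State
    init = record { sets = λ _ → [] ; closed = λ _ → false ; last = λ _ → nothing }

    numClosed : State → ℕ
    numClosed s = sum (map (λ i → if closed s i then 1 else 0) (allFin K))

    add : State → Fin K → Fin n → State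
    add s i j = record
      { sets   = λ i' → if does (i' ≟ i) then newSet else sets s i'
      ; closed = λ i' → if does (i' ≟ i) then (if over then true else closed s i') else closed s i'
      ; last   = λ i' → if does (i' ≟ i) then (if over then just j else last s i') else last s i'
      }
      where
        newSet = j ∷ sets s i
        over   = does (B ℚP.<? 𝒲 newSet)

    CanAdd : State → Fin K → Fin n → Set
    CanAdd s i j = closed s i ≡ false × All (λ k → DisjointI j k) (sets s i)

    -- reachable states of the loop, paired with the deliveries not yet processed
    data Reach (ord : List (Fin n)) : State → List (Fin n) → Set where
      start : Reach ord init ord
      step  : ∀ {s j js} → Reach ord s (j ∷ js) → ¬ (numClosed s ≡ m) →
              (i : Fin K) → CanAdd s i j → Reach ord (add s i j) js

    Final : List (Fin n) → State → Set
    Final ord s = ∃[ js ] (Reach ord s js × (js ≡ [] ⊎ numClosed s ≡ m))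

    post : State → Fin K → List (Fin n)
    post s i with closed s i | last s i
    ... | true | just j =
          let rest = filter (λ k → ¬? (k ≟ j)) (sets s i) in
          if does (𝒫 (j ∷ []) ℚP.≤? 𝒫 rest) then rest else j ∷ []
    ... | _ | _ = sets s i

    TopM : State → (Fin m → Fin K) → Set
    TopM s sel =
      (∀ a b → sel a ≡ sel b → a ≡ b) ×
      (∀ i → (∀ a → sel a ≢ i) → ∀ a → 𝒫 (post s i) ℚ.≤ 𝒫 (post s (sel a)))

{-# OPTIONS --safe #-}
module Submission where

-- The main loop keeps an invariant: the slots are pairwise disjoint compatible
-- sets, disjoint from the deliveries still to be processed; an open slot is
-- within budget, and a closed slot exceeds it only through its last delivery
-- L_i; fewer than m slots are closed while the loop runs.  Post-processing then
-- keeps either S_i ∖ L_i or L_i, both feasible, and distinct output slots stay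
-- disjoint.  The loop never gets stuck: if delivery j fits into no open slot,
-- each of the more than Δ open slots holds its own neighbour of j in the
-- interval graph, which exceeds the maximum degree Δ.

open import Defs
open import Data.Bool using (Bool; true; false; if_then_else_; not)
open import Data.Empty using (⊥-elim)
open import Data.Fin using (Fin; _≟_)
open import Data.List using (List; []; _∷_; filter; length; map; allFin)
open import Data.List.Membership.Propositional using (_∈_; _∉_; find)
open import Data.List.Properties using (length-tabulate)
open import Data.List.Relation.Binary.Permutation.Propositional using (_↭_; ↭-sym; ↭⇒↭ₛ)
open import Data.List.Relation.Binary.Permutation.Setoid.Properties using (Unique-resp-↭)
open import Data.List.Relation.Unary.All as All using (All; []; _∷_)
open import Data.List.Relation.Unary.All.Properties using (¬Any⇒All¬)
open import Data.List.Relation.Unary.AllPairs as AllPairs using ([]; _∷_)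
open import Data.List.Relation.Unary.AllPairs.Properties using (filter⁺)
open import Data.List.Relation.Binary.Subset.Propositional using (_⊆_)
open import Data.List.Relation.Binary.Subset.Propositional.Properties using (filter-⊆)
open import Data.List.Relation.Unary.Any using (here; there; any?)
open import Data.List.Relation.Unary.Unique.Propositional using (Unique)
open import Data.List.Relation.Unary.Unique.Propositional.Properties using (allFin⁺)
open import Data.Maybe using (just; nothing)
open import Data.Maybe.Properties using (just-injective)
open import Data.Nat using (ℕ; suc; _+_; _≤_; _<_; z≤n; s≤s)
open import Data.Nat.ListAction using (sum)
open import Data.Nat.Properties using (+-suc; ≤-reflexive; +-mono-≤; +-monoʳ-≤; m≤n+m; ≤-trans; ≤∧≢⇒<; <-irrefl)
open import Data.Product using (_×_; _,_; proj₁; proj₂; ∃-syntax)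
open import Data.Sum using (_⊎_; inj₁; inj₂)
import Data.Rational as ℚ
import Data.Rational.Properties as ℚP
open import Relation.Binary.Definitions using (DecidableEquality)
open import Relation.Binary.PropositionalEquality using (_≡_; _≢_; refl; sym; trans; cong; subst; setoid)
open import Relation.Nullary using (¬_; Dec; yes; no; does; ¬?)
open import Relation.Unary using (Decidable)
open import Function using (_∘_; id)

private
  variable
    A : Set

Unique-↭ : {xs ys : List A} → xs ↭ ys → Unique ys → Unique xs
Unique-↭ xs↭ys = Unique-resp-↭ (setoid _) (↭⇒↭ₛ (↭-sym xs↭ys))

bit : Bool → ℕ
bit b = if b then 1 else 0

bit≤1 : ∀ b → bit b ≤ 1
bit≤1 true  = s≤s z≤n
bit≤1 false = z≤n

if-does-true≡false⇒¬ : ∀ {P : Set} {b} (P? : Dec P) → (if does P? then true else b) ≡ false → ¬ P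
if-does-true≡false⇒¬ (yes _) ()
if-does-true≡false⇒¬ (no ¬p) _ = ¬p

if-does-true≡true⇒then : ∀ {P : Set} {b} {x y : A} (P? : Dec P) → b ≡ false →
                          (if does P? then true else b) ≡ true → (if does P? then x else y) ≡ x
if-does-true≡true⇒then (yes _) _    _    = refl
if-does-true≡true⇒then (no _)  refl ()

if-preserves : ∀ (Q : A → Set) b {x y} → Q x → Q y → Q (if b then x else y)
if-preserves Q true  qx _  = qx
if-preserves Q false _  qy = qy

countTrue : (A → Bool) → List A → ℕ
countTrue f xs = sum (map (λ x → bit (f x)) xs)

countTrue-∷ : ∀ {f : A → Bool} {x b} xs → f x ≡ b → countTrue f (x ∷ xs) ≡ bit b + countTrue f xs
countTrue-∷ _ refl = refl

countTrue-const-false : ∀ (xs : List A) → countTrue (λ _ → false) xs ≡ 0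
countTrue-const-false []       = refl
countTrue-const-false (_ ∷ xs) = countTrue-const-false xs

countTrue-cong-local : ∀ {f g : A → Bool} {xs} → All (λ x → g x ≡ f x) xs →
                       countTrue g xs ≡ countTrue f xs
countTrue-cong-local []            = refl
countTrue-cong-local (gx≡fx ∷ eqs) rewrite gx≡fx | countTrue-cong-local eqs = refl

countTrue-update-≤ : DecidableEquality A → ∀ {f g : A → Bool} {a} → (∀ x → x ≢ a → g x ≡ f x) →
                     ∀ {xs} → Unique xs → countTrue g xs ≤ suc (countTrue f xs)
countTrue-update-≤ _≟_ _ {[]} [] = z≤n
countTrue-update-≤ _≟_ {f} {g} {a} g≐f {x ∷ xs} (x∉xs ∷ uniq) with x ≟ a
... | yes refl = +-mono-≤ (bit≤1 (g x)) (≤-trans (≤-reflexive g≐f-on-xs) (m≤n+m _ _))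
  where
    g≐f-on-xs : countTrue g xs ≡ countTrue f xs
    g≐f-on-xs = countTrue-cong-local (All.map (λ x≢y → g≐f _ (λ y≡x → x≢y (sym y≡x))) x∉xs)
... | no x≢a rewrite g≐f x x≢a =
  subst (bit (f x) + countTrue g xs ≤_) (+-suc (bit (f x)) (countTrue f xs))
        (+-monoʳ-≤ (bit (f x)) (countTrue-update-≤ _≟_ g≐f uniq))

countTrue+countFalse : ∀ (f : A → Bool) xs → countTrue f xs + countTrue (λ x → not (f x)) xs ≡ length xs
countTrue+countFalse f []       = refl
countTrue+countFalse f (x ∷ xs) with f x
... | true  = cong suc (countTrue+countFalse f xs)
... | false = trans (+-suc (countTrue f xs) _) (cong suc (countTrue+countFalse f xs))

module _ (inst : Instance) where
  open MDSP inst

  -- The later of the two left endpoints is a common point.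
  Intersect? : ∀ j k → Dec (Intersect j k)
  Intersect? j k with tL j ℚP.≤? tR k | tL k ℚP.≤? tR j
  ... | yes j≤k | yes k≤j =
    yes (tL j ℚ.⊔ tL k , (ℚP.p≤p⊔q (tL j) (tL k) , ℚP.⊔-lub (interval j) k≤j) ,
                          (ℚP.p≤q⊔p (tL j) (tL k) , ℚP.⊔-lub j≤k (interval k)))
  ... | no j≰k | _     = no λ { (_ , (lj , _) , (_ , rk)) → j≰k (ℚP.≤-trans lj rk) }
  ... | yes _ | no k≰j = no λ { (_ , (_ , rj) , (lk , _)) → k≰j (ℚP.≤-trans lk rj) }

  disjointAll-or-meets : ∀ j xs → All (DisjointI j) xs ⊎ ∃[ k ] (k ∈ xs × Intersect j k)
  disjointAll-or-meets j xs with any? (Intersect? j) xs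
  ... | yes meets = inj₂ (find meets)
  ... | no ¬meets = inj₁ (¬Any⇒All¬ xs ¬meets)

  𝒲≤c+𝒲 : ∀ k xs → 𝒲 xs ℚ.≤ 𝒲 (k ∷ xs)
  𝒲≤c+𝒲 k xs = subst (ℚ._≤ 𝒲 (k ∷ xs)) (ℚP.+-identityˡ (𝒲 xs))
                      (ℚP.+-monoˡ-≤ (𝒲 xs) (ℚP.<⇒≤ (c-pos k)))

  𝒲-filter-≤ : ∀ {P : Fin n → Set} (P? : Decidable P) xs → 𝒲 (filter P? xs) ℚ.≤ 𝒲 xs
  𝒲-filter-≤ P? []       = ℚP.≤-refl
  𝒲-filter-≤ P? (x ∷ xs) with does (P? x)
  ... | true  = ℚP.+-monoʳ-≤ (c x) (𝒲-filter-≤ P? xs)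
  ... | false = ℚP.≤-trans (𝒲-filter-≤ P? xs) (𝒲≤c+𝒲 x xs)

  𝒲-remove-head-≤ : ∀ j rest → 𝒲 (filter (λ k → ¬? (k ≟ j)) (j ∷ rest)) ℚ.≤ 𝒲 rest
  𝒲-remove-head-≤ j rest with j ≟ j
  ... | yes _   = 𝒲-filter-≤ _ rest
  ... | no j≢j = ⊥-elim (j≢j refl)

  𝒲-singleton-≤ : ∀ k → 𝒲 (k ∷ []) ℚ.≤ B
  𝒲-singleton-≤ k = subst (ℚ._≤ B) (sym (ℚP.+-identityʳ (c k))) (c≤B k)

  module _ (Δ : ℕ) where
    open Greedy Δ

    record LoopInvariant (s : State) (pending : List (Fin n)) : Set where
      field
        pending-unique : Unique pending
        placed∉pending : ∀ i k → k ∈ sets s i → k ∉ pending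
        slots-disjoint : ∀ i i′ → i ≢ i′ → ∀ k → k ∈ sets s i → k ∉ sets s i′
        slots-compatible : ∀ i → CompatibleSet (sets s i)
        open-within-budget : ∀ i → closed s i ≡ false → 𝒲 (sets s i) ℚ.≤ B
        closed-by-last : ∀ i → closed s i ≡ true →
          ∃[ j ] ∃[ rest ] (last s i ≡ just j × sets s i ≡ j ∷ rest × 𝒲 rest ℚ.≤ B)
        closed≤m : numClosed s ≤ m

    init-invariant : ∀ {ord} → Unique ord → LoopInvariant init ord
    init-invariant uniq = record
      { pending-unique = uniq
      ; placed∉pending = λ _ _ ()
      ; slots-disjoint = λ _ _ _ _ ()
      ; slots-compatible = λ _ → []
      ; open-within-budget = λ _ _ → ℚP.<⇒≤ B-pos
      ; closed-by-last = λ _ ()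
      ; closed≤m = subst (_≤ m) (sym (countTrue-const-false (allFin K))) z≤n
      }

    module AddStep {s j pending} (inv : LoopInvariant s (j ∷ pending)) (running : ¬ (numClosed s ≡ m))
                   (i : Fin K) (fits : CanAdd s i j) where
      open LoopInvariant inv

      i-open : closed s i ≡ false
      i-open = proj₁ fits

      j-fits : All (DisjointI j) (sets s i)
      j-fits = proj₂ fits

      s′ : State
      s′ = add s i j

      j∉pending : j ∉ pending
      j∉pending j∈ = All.lookup (AllPairs.head pending-unique) j∈ refl

      j∉slot : ∀ i′ → j ∉ sets s i′
      j∉slot i′ j∈ = placed∉pending i′ j j∈ (here refl)

      placed∉pending′ : ∀ i′ k → k ∈ sets s′ i′ → k ∉ pending
      placed∉pending′ i′ k k∈ k∈pending with i′ ≟ i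
      placed∉pending′ _ _ (here refl) k∈pending | yes refl = j∉pending k∈pending
      placed∉pending′ _ k (there k∈) k∈pending  | yes refl = placed∉pending i k k∈ (there k∈pending)
      placed∉pending′ i′ k k∈ k∈pending         | no _     = placed∉pending i′ k k∈ (there k∈pending)

      added-disjoint : ∀ i′ → i ≢ i′ → ∀ k → k ∈ j ∷ sets s i → k ∉ sets s i′
      added-disjoint i′ _    _ (here refl) = j∉slot i′
      added-disjoint i′ i≢i′ k (there k∈)  = slots-disjoint i i′ i≢i′ k k∈

      slots-disjoint′ : ∀ i₁ i₂ → i₁ ≢ i₂ → ∀ k → k ∈ sets s′ i₁ → k ∉ sets s′ i₂
      slots-disjoint′ i₁ i₂ i₁≢i₂ k k∈₁ k∈₂ with i₁ ≟ i | i₂ ≟ i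
      ... | yes refl | yes refl = i₁≢i₂ refl
      ... | yes refl | no _     = added-disjoint i₂ i₁≢i₂ k k∈₁ k∈₂
      ... | no _     | yes refl = added-disjoint i₁ (i₁≢i₂ ∘ sym) k k∈₂ k∈₁
      ... | no _     | no _     = slots-disjoint i₁ i₂ i₁≢i₂ k k∈₁ k∈₂

      slots-compatible′ : ∀ i′ → CompatibleSet (sets s′ i′)
      slots-compatible′ i′ with i′ ≟ i
      ... | yes refl = j-fits ∷ slots-compatible i
      ... | no _     = slots-compatible i′

      open-within-budget′ : ∀ i′ → closed s′ i′ ≡ false → 𝒲 (sets s′ i′) ℚ.≤ B
      open-within-budget′ i′ with i′ ≟ i
      ... | no _     = open-within-budget i′
      ... | yes refl = ℚP.≮⇒≥ ∘ if-does-true≡false⇒¬ (B ℚP.<? 𝒲 (j ∷ sets s i))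

      closed-by-last′ : ∀ i′ → closed s′ i′ ≡ true →
        ∃[ j′ ] ∃[ rest ] (last s′ i′ ≡ just j′ × sets s′ i′ ≡ j′ ∷ rest × 𝒲 rest ℚ.≤ B)
      closed-by-last′ i′ i′-closed with i′ ≟ i
      ... | no _     = closed-by-last i′ i′-closed
      ... | yes refl = j , sets s i , if-does-true≡true⇒then (B ℚP.<? 𝒲 (j ∷ sets s i)) i-open i′-closed ,
                       refl , open-within-budget i i-open

      closed≤m′ : numClosed s′ ≤ m
      closed≤m′ = ≤-trans (countTrue-update-≤ _≟_ unchanged (allFin⁺ K)) (≤∧≢⇒< closed≤m running)
        where
          unchanged : ∀ x → x ≢ i → closed s′ x ≡ closed s x
          unchanged x x≢i with x ≟ i
          ... | yes x≡i = ⊥-elim (x≢i x≡i)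
          ... | no _    = refl

      invariant : LoopInvariant s′ pending
      invariant = record
        { pending-unique = AllPairs.tail pending-unique
        ; placed∉pending = placed∉pending′
        ; slots-disjoint = slots-disjoint′
        ; slots-compatible = slots-compatible′
        ; open-within-budget = open-within-budget′
        ; closed-by-last = closed-by-last′
        ; closed≤m = closed≤m′
        }

    reach-invariant : ∀ {ord} → Unique ord → ∀ {s pending} → Reach ord s pending → LoopInvariant s pending
    reach-invariant uniq start                     = init-invariant uniq
    reach-invariant uniq (step reach running i fits) = AddStep.invariant (reach-invariant uniq reach) running i fits

    module _ {s j pending} (inv : LoopInvariant s (j ∷ pending)) where
      open LoopInvariant inv

      PlacedIn : List (Fin K) → Fin n → Set
      PlacedIn slots k = ∃[ i ] (i ∈ slots × k ∈ sets s i)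

      record Blockers (slots : List (Fin K)) : Set where
        field
          neighbours : List (Fin n)
          neighbourList : NeighbourList j neighbours
          placed : All (PlacedIn slots) neighbours
          length≡open : length neighbours ≡ countTrue (λ i → not (closed s i)) slots

      placedIn-∷ : ∀ {i slots k} → PlacedIn slots k → PlacedIn (i ∷ slots) k
      placedIn-∷ (i′ , i′∈ , k∈) = i′ , there i′∈ , k∈

      placed-elsewhere-≢ : ∀ {i slots k ks} → All (i ≢_) slots → k ∈ sets s i →
                           All (PlacedIn slots) ks → All (k ≢_) ks
      placed-elsewhere-≢ i∉slots k∈ = All.map λ { (i′ , i′∈ , k′∈) refl →
        slots-disjoint _ i′ (All.lookup i∉slots i′∈) _ k∈ k′∈ }

      fits-or-blocked : ∀ slots → Unique slots → (∃[ i ] CanAdd s i j) ⊎ Blockers slots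
      fits-or-blocked [] [] = inj₂ record
        { neighbours = [] ; neighbourList = [] , [] ; placed = [] ; length≡open = refl }
      fits-or-blocked (i ∷ slots) (i∉slots ∷ uniq) with fits-or-blocked slots uniq
      ... | inj₁ fits = inj₁ fits
      ... | inj₂ b with closed s i in i-closed | disjointAll-or-meets j (sets s i)
      ...   | true  | _ = inj₂ record
        { neighbours = neighbours ; neighbourList = neighbourList
        ; placed = All.map placedIn-∷ placed
        ; length≡open = trans length≡open (sym (countTrue-∷ slots (cong not i-closed)))
        }
        where open Blockers b
      ...   | false | inj₁ j-fits = inj₁ (i , i-closed , j-fits)
      ...   | false | inj₂ (k , k∈ , meets) = inj₂ record
        { neighbours = k ∷ neighbours
        ; neighbourList = placed-elsewhere-≢ i∉slots k∈ placed ∷ proj₁ neighbourList ,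
                          ((λ { refl → placed∉pending i k k∈ (here refl) }) , meets) ∷ proj₂ neighbourList
        ; placed = (i , here refl , k∈) ∷ All.map placedIn-∷ placed
        ; length≡open = trans (cong suc length≡open) (sym (countTrue-∷ slots (cong not i-closed)))
        }
        where open Blockers b

    loop-never-stuck : IsMaxDegree Δ → ∀ {s j pending} → LoopInvariant s (j ∷ pending) →
                       ¬ (numClosed s ≡ m) → ∃[ i ] CanAdd s i j
    loop-never-stuck (degree≤Δ , _) {s} {j} inv running with fits-or-blocked inv (allFin K) (allFin⁺ K)
    ... | inj₁ fits = fits
    ... | inj₂ b    = ⊥-elim (<-irrefl refl K<K)
      where
        open Blockers b
        open≤Δ : countTrue (λ i → not (closed s i)) (allFin K) ≤ Δ
        open≤Δ = subst (_≤ Δ) length≡open (degree≤Δ j neighbours neighbourList)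
        closed+open≡K : numClosed s + countTrue (λ i → not (closed s i)) (allFin K) ≡ K
        closed+open≡K = trans (countTrue+countFalse (closed s) (allFin K)) (length-tabulate id)
        K<K : K < K
        K<K = subst (_≤ K) (cong suc closed+open≡K)
                    (+-mono-≤ (≤∧≢⇒< (LoopInvariant.closed≤m inv) running) open≤Δ)

    post-feasible-⊆ : ∀ {s pending} → LoopInvariant s pending → ∀ i →
                      FeasibleSet (post s i) × post s i ⊆ sets s i
    post-feasible-⊆ {s} inv i with closed s i in i-closed | last s i in i-last
    ... | false | _ = (slots-compatible i , open-within-budget i i-closed) , id
      where open LoopInvariant inv
    ... | true | nothing with LoopInvariant.closed-by-last inv i i-closed
    ...   | _ , _ , last≡ , _ with () ← trans (sym i-last) last≡
    post-feasible-⊆ {s} inv i | true | just j with LoopInvariant.closed-by-last inv i i-closed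
    ... | _ , rest , last≡ , sets≡ , rest≤B with just-injective (trans (sym i-last) last≡)
    ...   | refl = if-preserves (λ S → FeasibleSet S × S ⊆ sets s i) _
                     ((filter⁺ _ (slots-compatible i) , without-j≤B) , filter-⊆ _ (sets s i))
                     (([] ∷ [] , 𝒲-singleton-≤ j) , λ { (here refl) → subst (j ∈_) (sym sets≡) (here refl) })
      where
        open LoopInvariant inv
        without-j≤B : 𝒲 (filter (λ k → ¬? (k ≟ j)) (sets s i)) ℚ.≤ B
        without-j≤B = subst (λ S → 𝒲 (filter (λ k → ¬? (k ≟ j)) S) ℚ.≤ B) (sym sets≡)
                            (ℚP.≤-trans (𝒲-remove-head-≤ j rest) rest≤B)

    output-feasible : ∀ {s pending} → LoopInvariant s pending → (sel : Fin m → Fin K) →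
                      (∀ a b → sel a ≡ sel b → a ≡ b) → FeasibleSolution (λ a → post s (sel a))
    output-feasible inv sel sel-injective =
      (λ a → proj₁ (post-feasible-⊆ inv (sel a))) ,
      λ a b a≢b k k∈a k∈b →
        LoopInvariant.slots-disjoint inv (sel a) (sel b) (a≢b ∘ sel-injective a b) k
          (proj₂ (post-feasible-⊆ inv (sel a)) k∈a) (proj₂ (post-feasible-⊆ inv (sel b)) k∈b)

lemma3 : (inst : Instance) → let open MDSP inst in
         (Δ : ℕ) → IsMaxDegree Δ →
         (ord : List (Fin n)) → SortedByDensity ord →
         let open Greedy Δ in
         -- the loop never gets stuck: a suitable open slot always exists
         (∀ s j js → Reach ord s (j ∷ js) → ¬ (numClosed s ≡ m) →
            ∃[ i ] CanAdd s i j)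
         ×
         -- every output (any choices / tie-breaking) is a feasible solution
         (∀ s → Final ord s → (sel : Fin m → Fin K) → TopM s sel →
            FeasibleSolution (λ a → post s (sel a)))
lemma3 inst Δ max-degree ord (ord↭allFin , _) =
  (λ _ _ _ reach running → loop-never-stuck inst Δ max-degree (invariant reach) running) ,
  (λ { _ (_ , reach , _) sel (sel-injective , _) → output-feasible inst Δ (invariant reach) sel sel-injective })
  where
    invariant : ∀ {s pending} → MDSP.Greedy.Reach inst Δ ord s pending → LoopInvariant inst Δ s pending
    invariant = reach-invariant inst Δ (Unique-↭ ord↭allFin (allFin⁺ _))
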